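{- Let $X$ be a finite set and $\mathcal{D}\subseteq\mathcal{R}(X)$. Then $\mathcal{D}$ is a median domain if and only if the family of all convex subsets of $\mathcal{D}$ has the Helly property.
   Context: $\mathcal{R}(X)$ is the set of strict linear orders on $X$. For $R,R'\in\mathcal{R}(X)$ let $[R,R']=\{Q\in\mathcal{R}(X): Q\supseteq R\cap R'\}$. $\mathcal{D}$ is a median domain if for all $R_1,R_2,R_3\in\mathcal{D}$ there exists $R\in\mathcal{D}\cap[R_1,R_2]\cap[R_1,R_3]\cap[R_2,R_3]$. A subset $\mathcal{C}\subseteq\mathcal{D}$ is convex if $R,R'\in\mathcal{C}$ implies $[R,R']\cap\mathcal{D}\subseteq\mathcal{C}$. A family $\mathbb{F}$ of sets has the Helly property if for every subfamily $\mathbb{F}'\subseteq\mathbb{F}$ whose members pairwise intersect, $\bigcap\mathbb{F}'\neq\emptyset$. -}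

module Defs where

open import Data.Nat using (ℕ; suc)
open import Data.Fin using (Fin)
open import Data.Product using (Σ; ∃; _×_)
open import Data.Sum using (_⊎_)
open import Relation.Binary.PropositionalEquality using (_≡_; _≢_)
open import Relation.Nullary using (¬_)

-- X = Fin n (an arbitrary finite set).  A binary relation on X.
BinRel : ℕ → Set₁
BinRel n = Fin n → Fin n → Set

IsStrictLinearOrder : ∀ {n} → BinRel n → Set
IsStrictLinearOrder {n} R =
  (∀ x → ¬ R x x) ×
  (∀ x y z → R x y → R y z → R x z) ×
  (∀ x y → x ≢ y → R x y ⊎ R y x)

RelSet : ℕ → Set₁
RelSet n = BinRel n → Set

_⊆ᴿ_ : ∀ {n} → RelSet n → RelSet n → Set₁
A ⊆ᴿ B = ∀ R → A R → B R

IsDomain : ∀ {n} → RelSet n → Set₁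
IsDomain 𝒟 = ∀ R → 𝒟 R → IsStrictLinearOrder R

Between : ∀ {n} → BinRel n → BinRel n → RelSet n
Between R R' Q = IsStrictLinearOrder Q × (∀ x y → R x y → R' x y → Q x y)

IsMedianDomain : ∀ {n} → RelSet n → Set₁
IsMedianDomain 𝒟 =
  ∀ R₁ R₂ R₃ → 𝒟 R₁ → 𝒟 R₂ → 𝒟 R₃ →
  ∃ λ R → 𝒟 R × Between R₁ R₂ R × Between R₁ R₃ R × Between R₂ R₃ R

IsConvex : ∀ {n} → RelSet n → RelSet n → Set₁
IsConvex 𝒟 𝒞 =
  (𝒞 ⊆ᴿ 𝒟) ×
  (∀ R R' → 𝒞 R → 𝒞 R' → ∀ Q → Between R R' Q → 𝒟 Q → 𝒞 Q)

-- Helly property of the family of all convex subsets of 𝒟: every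
-- nonempty (necessarily finite, as 𝒟 is finite) subfamily, listed as
-- 𝒞 : Fin (suc k) → RelSet n, whose members pairwise intersect has a
-- common point.
ConvexHelly : ∀ {n} → RelSet n → Set₁
ConvexHelly {n} 𝒟 =
  ∀ k (𝒞 : Fin (suc k) → RelSet n) →
  (∀ i → IsConvex 𝒟 (𝒞 i)) →
  (∀ i j → ∃ λ R → 𝒞 i R × 𝒞 j R) →
  ∃ λ R → ∀ i → 𝒞 i R

module Submission where

-- The proof separates a purely combinatorial fact from the order theory.
-- (1) For any family of sets closed under binary intersection, the Helly
--     property for three sets already implies it for any finite number
--     (induction: intersect every set with the first one).
-- (2) Convex subsets of 𝒟 are closed under intersection, and in a median
--     domain three pairwise intersecting convex sets meet: a median of one
--     point from each pairwise intersection lies in all three sets.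
-- (3) Conversely, the "intervals" [R,R'] ∩ 𝒟 are convex and contain their
--     endpoints, so for R₁, R₂, R₃ ∈ 𝒟 the three intervals pairwise meet at
--     the shared endpoints; a common point of them is exactly a median.
-- Helly (1)+(2) gives one direction and (3) the other.

open import Defs
open import Level using (Level; _⊔_)
open import Data.Nat using (ℕ; zero; suc)
open import Data.Fin using (Fin; zero; suc)
open import Data.Product using (∃; _×_; _,_; proj₁; proj₂)
open import Function.Bundles using (_⇔_; mk⇔)

module HellyFromTriples {a ℓ g : Level} {P : Set a} (Good : (P → Set ℓ) → Set g) where

  Meet : (P → Set ℓ) → (P → Set ℓ) → Set (a ⊔ ℓ)
  Meet A B = ∃ λ p → A p × B p

  Helly : Set (a ⊔ Level.suc ℓ ⊔ g)
  Helly = ∀ k (𝒞 : Fin (suc k) → P → Set ℓ) →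
    (∀ i → Good (𝒞 i)) → (∀ i j → Meet (𝒞 i) (𝒞 j)) → ∃ λ p → ∀ i → 𝒞 i p

  TripleHelly : Set (a ⊔ Level.suc ℓ ⊔ g)
  TripleHelly = ∀ A B C → Good A → Good B → Good C →
    Meet A B → Meet B C → Meet A C → ∃ λ p → A p × B p × C p

  ClosedUnderMeet : Set (a ⊔ Level.suc ℓ ⊔ g)
  ClosedUnderMeet = ∀ A B → Good A → Good B → Good (λ p → A p × B p)

  -- Induction on the size of the family: replace 𝒞₁,…,𝒞ₖ by 𝒞ᵢ ∩ 𝒞₀.
  -- These are good, and pairwise meet by the triple property applied to
  -- 𝒞ᵢ, 𝒞ⱼ, 𝒞₀; a common point of them is common to the whole family.
  tripleHelly⇒helly : ClosedUnderMeet → TripleHelly → Helly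
  tripleHelly⇒helly ∩-good helly₃ zero 𝒞 good meet with meet zero zero
  ... | p , p∈𝒞₀ , _ = p , λ { zero → p∈𝒞₀ }
  tripleHelly⇒helly ∩-good helly₃ (suc k) 𝒞 good meet
    with tripleHelly⇒helly ∩-good helly₃ k 𝒞' good' meet'
    where
      𝒞' : Fin (suc k) → P → Set ℓ
      𝒞' i p = 𝒞 (suc i) p × 𝒞 zero p

      good' : ∀ i → Good (𝒞' i)
      good' i = ∩-good (𝒞 (suc i)) (𝒞 zero) (good (suc i)) (good zero)

      meet' : ∀ i j → Meet (𝒞' i) (𝒞' j)
      meet' i j with helly₃ (𝒞 (suc i)) (𝒞 (suc j)) (𝒞 zero)
                            (good (suc i)) (good (suc j)) (good zero)
                            (meet (suc i) (suc j)) (meet (suc j) zero) (meet (suc i) zero)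
      ... | p , p∈𝒞ᵢ , p∈𝒞ⱼ , p∈𝒞₀ = p , (p∈𝒞ᵢ , p∈𝒞₀) , (p∈𝒞ⱼ , p∈𝒞₀)
  ... | p , p∈𝒞' = p , λ { zero → proj₂ (p∈𝒞' zero) ; (suc i) → proj₁ (p∈𝒞' i) }

module _ {n : ℕ} (𝒟 : RelSet n) where

  open HellyFromTriples (IsConvex 𝒟)

  convex-∩ : ClosedUnderMeet
  convex-∩ A B (A⊆𝒟 , A-convex) (_ , B-convex) =
    (λ R R∈A∩B → A⊆𝒟 R (proj₁ R∈A∩B)) ,
    λ R R' (R∈A , R∈B) (R'∈A , R'∈B) Q Q∈[R,R'] Q∈𝒟 →
      A-convex R R' R∈A R'∈A Q Q∈[R,R'] Q∈𝒟 , B-convex R R' R∈B R'∈B Q Q∈[R,R'] Q∈𝒟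

  -- In a median domain three pairwise meeting convex sets meet: take
  -- R ∈ A∩B, R' ∈ B∩C, R'' ∈ A∩C; their median lies in [R,R''] ⊆ A,
  -- in [R,R'] ⊆ B and in [R',R''] ⊆ C.
  median⇒tripleHelly : IsMedianDomain 𝒟 → TripleHelly
  median⇒tripleHelly median A B C (A⊆𝒟 , A-convex) (B⊆𝒟 , B-convex) (_ , C-convex)
                     (R , R∈A , R∈B) (R' , R'∈B , R'∈C) (R'' , R''∈A , R''∈C)
    with median R R' R'' (A⊆𝒟 R R∈A) (B⊆𝒟 R' R'∈B) (A⊆𝒟 R'' R''∈A)
  ... | M , M∈𝒟 , M∈[R,R'] , M∈[R,R''] , M∈[R',R''] =
    M , A-convex R R'' R∈A R''∈A M M∈[R,R''] M∈𝒟
      , B-convex R R' R∈B R'∈B M M∈[R,R'] M∈𝒟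
      , C-convex R' R'' R'∈C R''∈C M M∈[R',R''] M∈𝒟

  median⇒helly : IsMedianDomain 𝒟 → ConvexHelly 𝒟
  median⇒helly median = tripleHelly⇒helly convex-∩ (median⇒tripleHelly median)

  Interval : BinRel n → BinRel n → RelSet n
  Interval R R' Q = 𝒟 Q × Between R R' Q

  -- Intervals are convex: any Q ⊇ S ∩ S' with S, S' ⊇ R ∩ R' contains R ∩ R'.
  interval-convex : ∀ R R' → IsConvex 𝒟 (Interval R R')
  interval-convex R R' =
    (λ Q Q∈I → proj₁ Q∈I) ,
    λ S S' (_ , _ , S⊇R∩R') (_ , _ , S'⊇R∩R') Q (Q-linear , Q⊇S∩S') Q∈𝒟 →
      Q∈𝒟 , Q-linear , λ x y xRy xR'y → Q⊇S∩S' x y (S⊇R∩R' x y xRy xR'y) (S'⊇R∩R' x y xRy xR'y)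

  module _ (domain : IsDomain 𝒟) where

    left∈interval : ∀ R R' → 𝒟 R → Interval R R' R
    left∈interval R R' R∈𝒟 = R∈𝒟 , domain R R∈𝒟 , λ x y xRy _ → xRy

    right∈interval : ∀ R R' → 𝒟 R' → Interval R R' R'
    right∈interval R R' R'∈𝒟 = R'∈𝒟 , domain R' R'∈𝒟 , λ x y _ xR'y → xR'y

    -- A common point of [R₁,R₂], [R₁,R₃], [R₂,R₃] in 𝒟 is a median; the
    -- three intervals pairwise share an endpoint.
    helly⇒median : ConvexHelly 𝒟 → IsMedianDomain 𝒟
    helly⇒median helly R₁ R₂ R₃ R₁∈𝒟 R₂∈𝒟 R₃∈𝒟
      with helly 2 sides sides-convex meet
      where
        sides : Fin 3 → RelSet n
        sides zero             = Interval R₁ R₂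
        sides (suc zero)       = Interval R₁ R₃
        sides (suc (suc zero)) = Interval R₂ R₃

        sides-convex : ∀ i → IsConvex 𝒟 (sides i)
        sides-convex zero             = interval-convex R₁ R₂
        sides-convex (suc zero)       = interval-convex R₁ R₃
        sides-convex (suc (suc zero)) = interval-convex R₂ R₃

        R₁∈₁₂ : Interval R₁ R₂ R₁
        R₁∈₁₂ = left∈interval R₁ R₂ R₁∈𝒟
        R₁∈₁₃ : Interval R₁ R₃ R₁
        R₁∈₁₃ = left∈interval R₁ R₃ R₁∈𝒟
        R₂∈₁₂ : Interval R₁ R₂ R₂
        R₂∈₁₂ = right∈interval R₁ R₂ R₂∈𝒟
        R₂∈₂₃ : Interval R₂ R₃ R₂
        R₂∈₂₃ = left∈interval R₂ R₃ R₂∈𝒟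
        R₃∈₁₃ : Interval R₁ R₃ R₃
        R₃∈₁₃ = right∈interval R₁ R₃ R₃∈𝒟
        R₃∈₂₃ : Interval R₂ R₃ R₃
        R₃∈₂₃ = right∈interval R₂ R₃ R₃∈𝒟

        meet : ∀ i j → Meet (sides i) (sides j)
        meet zero             zero             = R₁ , R₁∈₁₂ , R₁∈₁₂
        meet zero             (suc zero)       = R₁ , R₁∈₁₂ , R₁∈₁₃
        meet zero             (suc (suc zero)) = R₂ , R₂∈₁₂ , R₂∈₂₃
        meet (suc zero)       zero             = R₁ , R₁∈₁₃ , R₁∈₁₂
        meet (suc zero)       (suc zero)       = R₁ , R₁∈₁₃ , R₁∈₁₃
        meet (suc zero)       (suc (suc zero)) = R₃ , R₃∈₁₃ , R₃∈₂₃
        meet (suc (suc zero)) zero             = R₂ , R₂∈₂₃ , R₂∈₁₂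
        meet (suc (suc zero)) (suc zero)       = R₃ , R₃∈₂₃ , R₃∈₁₃
        meet (suc (suc zero)) (suc (suc zero)) = R₂ , R₂∈₂₃ , R₂∈₂₃
    ... | M , M∈sides =
      M , proj₁ (M∈sides zero)
        , proj₂ (M∈sides zero) , proj₂ (M∈sides (suc zero)) , proj₂ (M∈sides (suc (suc zero)))

proposition2p2 : (n : ℕ) (𝒟 : RelSet n) → IsDomain 𝒟 →
    IsMedianDomain 𝒟 ⇔ ConvexHelly 𝒟
proposition2p2 n 𝒟 domain = mk⇔ (median⇒helly 𝒟) (helly⇒median 𝒟 domain)
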